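{- Fix a positive integer $k$ and $0\le l\le k$. Let $\psi$ be a formula of $\mathit{MS}_0$ with $\mathrm{Var}(\psi)=\{X_1,\ldots,X_k\}$ and $\mathrm{Fr}(\psi)=\{X_1,\ldots,X_l\}$, in prenex form $\psi=Q_{l+1}X_{l+1}\cdots Q_kX_k\,\psi'$ with each $Q_i\in\{\exists,\forall\}$ and $\psi'$ quantifier-free with $\mathrm{Var}(\psi')=\{X_1,\ldots,X_k\}$. Let $\mathcal{M}=(M,Y_1,\ldots,Y_l)$ and $\mathcal{M}'=(M',Y_1',\ldots,Y_l')$ be $l$-stacked matroids where $M$ and $M'$ have disjoint ground sets. Then the $l$-stacked matroid $(M\oplus M',Y_1\cup Y_1',\ldots,Y_l\cup Y_l')$ satisfies $\psi$ if and only if the trees $\mathcal{T}(\mathcal{M})$ and $\mathcal{T}(\mathcal{M}')$ are compatible relative to $\psi$.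
   Context: Matroids are finite; $\oplus$ is direct sum. $\mathit{MS}_0$: variables $X_1,X_2,\ldots$; atomic formulas $X_i\subseteq X_j$, $\mathrm{Sing}(X_i)$, $\mathrm{Ind}(X_i)$; connectives $\neg,\land$; quantifiers $\exists,\forall$; formulas with variable sets $\mathrm{Var}$ and free-variable sets $\mathrm{Fr}$ built recursively (atomic: $\mathrm{Fr}=\mathrm{Var}=$ variables occurring; $\neg$ preserves both; $\psi_1\land\psi_2$ allowed when no variable is free in one and bound in the other, taking unions; $\exists X_i\psi,\forall X_i\psi$ allowed for $X_i\in\mathrm{Fr}(\psi)$, removing $X_i$ from $\mathrm{Fr}$). Semantics in a matroid $M$: variables range over subsets of $E(M)$, $\subseteq$ is containment, $\mathrm{Sing}(X)$ means $|X|=1$, $\mathrm{Ind}(X)$ means $X$ is independent in $M$. An $l$-stacked matroid ($0\le l\le k$) is a tuple $(M,Y_1,\ldots,Y_l)$ with each $Y_i\subseteq E(M)$; it satisfies a formula with free variables $X_1,\ldots,X_l$ if $M$ satisfies it when each $X_i$ is interpreted as $Y_i$. A registry is a $(k+2)\times k$ matrix with rows indexed by $\mathrm{Ind},\mathrm{Sing},X_1,\ldots,X_k$ and columns by $X_1,\ldots,X_k$; entries in rows $\mathrm{Ind}$ and $X_i$ are in $\{T,F\}$, entries in row $\mathrm{Sing}$ are in $\{<,=,>\}$. A depth-0 tree is a registry; a depth-$(i+1)$ tree is a nonempty set of depth-$i$ trees (its children). For a $k$-stacked matroid $\mathcal{M}=(M,Y_1,\ldots,Y_k)$, $\mathcal{T}(\mathcal{M})$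 is the registry whose $(\mathrm{Ind},X_i)$ entry is $T$ iff $Y_i$ is independent in $M$, whose $(X_i,X_j)$ entry is $T$ iff $Y_i\subseteq Y_j$, and whose $(\mathrm{Sing},X_i)$ entry is $<,=,>$ according as $|Y_i|$ is less than, equal to, or greater than $1$. For $l<k$, $\mathcal{T}(M,Y_1,\ldots,Y_l)=\{\mathcal{T}(M,Y_1,\ldots,Y_l,Y_{l+1}):Y_{l+1}\subseteq E(M)\}$, a depth-$(k-l)$ tree. The sum of two registries is the $(k+2)\times k$ matrix over $\{T,F\}$ obtained entrywise: in rows $\mathrm{Ind}$ and $X_i$ the sum is $T$ iff both entries are $T$; in row $\mathrm{Sing}$ the sum is $T$ iff one entry is $<$ and the other is $=$. A quantifier-free formula $\varphi$ with variables among $X_1,\ldots,X_k$ is evaluated on such a $\{T,F\}$-matrix $\omega$ by giving $X_i\subseteq X_j$, $\mathrm{Ind}(X_i)$, $\mathrm{Sing}(X_i)$ the truth values of the entries $(X_i,X_j)$, $(\mathrm{Ind},X_i)$, $(\mathrm{Sing},X_i)$ of $\omega$. Compatibility of two depth-$(k-l)$ trees $\mathcal{T},\mathcal{T}'$ relative to $\psi=Q_{l+1}X_{l+1}\cdots Q_kX_k\psi'$ (as in the claim) is defined recursively: if $l=k$, they are compatible iff $\psi$ evaluates to $T$ on the sum of the registries $\mathcal{T},\mathcal{T}'$. If $l<k$, let $\psi_1=Q_{l+2}X_{l+2}\cdots Q_kX_k\psi'$; if $Q_{l+1}=\exists$, they are compatible iff some child $\mathcal{T}_0\in\mathcal{T}$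 and some child $\mathcal{T}_0'\in\mathcal{T}'$ are compatible relative to $\psi_1$; if $Q_{l+1}=\forall$, iff every $\mathcal{T}_0\in\mathcal{T}$ and every $\mathcal{T}_0'\in\mathcal{T}'$ are compatible relative to $\psi_1$. -}

module Defs where

open import Data.Nat using (ℕ; zero; suc; _<_; _≤‴_; ≤‴-reflexive; ≤‴-step)
open import Data.Bool using (Bool; true; false; _∧_; _∨_)
open import Data.Fin using (Fin)
open import Data.Fin.Subset using (Subset; _⊆_; _∈_; _∉_; _∪_; ⁅_⁆; ∣_∣) renaming (⊥ to ∅)
open import Data.Fin.Subset.Properties using (_⊆?_)
open import Data.Vec using (Vec; []; _∷_; lookup; _∷ʳ_; splitAt; _++_)
open import Data.List.NonEmpty using (List⁺; _∷_; [_]; toList; _⁺++⁺_) renaming (map to map⁺)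
open import Data.List.Relation.Unary.Any using (Any)
open import Data.List.Relation.Unary.All using (All)
open import Data.Product using (Σ; ∃; _×_; _,_; proj₁; proj₂)
open import Relation.Nullary using (¬_; Dec; does)
open import Relation.Unary using (Decidable)
open import Relation.Binary.PropositionalEquality using (_≡_; refl; subst)

record IndepStr (n : ℕ) : Set₁ where
  field
    Indep  : Subset n → Set
    Indep? : Decidable Indep
open IndepStr public

record IsMatroid {n : ℕ} (M : IndepStr n) : Set where
  field
    indep-∅   : Indep M ∅
    hereditary : ∀ X Y → Y ⊆ X → Indep M X → Indep M Y
    augment    : ∀ X Y → Indep M X → Indep M Y → ∣ X ∣ < ∣ Y ∣ →
                 ∃ λ e → e ∈ Y × e ∉ X × Indep M (X ∪ ⁅ e ⁆)

-- Direct sum: ground set Fin (n + m) = disjoint union of Fin n and Fin m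
-- (a subset of Fin (n + m) is Y ++ Y' with Y ⊆ E(M), Y' ⊆ E(M')).
_⊕_ : {n m : ℕ} → IndepStr n → IndepStr m → IndepStr (n Data.Nat.+ m)
_⊕_ {n} {m} M M' = record
  { Indep  = λ Z → Indep M (proj₁ (splitAt n Z)) × Indep M' (proj₁ (proj₂ (splitAt n Z)))
  ; Indep? = λ Z → Indep? M (proj₁ (splitAt n Z)) Relation.Nullary.×-dec Indep? M' (proj₁ (proj₂ (splitAt n Z)))
  }

-- MS_0 formulas.  Variable X_(i+1) is represented by i : Fin k.

data QF (k : ℕ) : Set where
  sub  : Fin k → Fin k → QF k
  sing : Fin k → QF k
  ind  : Fin k → QF k
  neg  : QF k → QF k
  and  : QF k → QF k → QF k

data Occurs {k : ℕ} (i : Fin k) : QF k → Set where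
  sub₁ : ∀ {j} → Occurs i (sub i j)
  sub₂ : ∀ {j} → Occurs i (sub j i)
  sing₀ : Occurs i (sing i)
  ind₀ : Occurs i (ind i)
  neg₀ : ∀ {φ} → Occurs i φ → Occurs i (neg φ)
  and₁ : ∀ {φ χ} → Occurs i φ → Occurs i (and φ χ)
  and₂ : ∀ {φ χ} → Occurs i χ → Occurs i (and φ χ)

-- Prenex k l : formulas Q_(l+1) X_(l+1) ... Q_k X_k ψ' with ψ' quantifier-free
-- over X_1..X_k; the free variables are X_1..X_l.
data Prenex (k : ℕ) : ℕ → Set where
  qf  : QF k → Prenex k k
  ex  : ∀ {l} → Prenex k (suc l) → Prenex k l
  all : ∀ {l} → Prenex k (suc l) → Prenex k l

matrix : ∀ {k l} → Prenex k l → QF k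
matrix (qf φ)  = φ
matrix (ex ψ)  = matrix ψ
matrix (all ψ) = matrix ψ

⟦_⟧ : ∀ {k n} → QF k → IndepStr n → Vec (Subset n) k → Set
⟦ sub i j ⟧ M Ys = lookup Ys i ⊆ lookup Ys j
⟦ sing i ⟧  M Ys = ∣ lookup Ys i ∣ ≡ 1
⟦ ind i ⟧   M Ys = Indep M (lookup Ys i)
⟦ neg φ ⟧   M Ys = ¬ ⟦ φ ⟧ M Ys
⟦ and φ χ ⟧ M Ys = ⟦ φ ⟧ M Ys × ⟦ χ ⟧ M Ys

Sat : ∀ {k l n} → IndepStr n → Vec (Subset n) l → Prenex k l → Set
Sat M Ys (qf φ)  = ⟦ φ ⟧ M Ys
Sat {n = n} M Ys (ex ψ)  = Σ (Subset n) λ Y → Sat M (Ys ∷ʳ Y) ψ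
Sat {n = n} M Ys (all ψ) = (Y : Subset n) → Sat M (Ys ∷ʳ Y) ψ

data Cmp : Set where
  lt eq gt : Cmp

record Registry (k : ℕ) : Set where
  field
    indR  : Fin k → Bool
    singR : Fin k → Cmp
    subR  : Fin k → Fin k → Bool
open Registry public

record BMatrix (k : ℕ) : Set where
  field
    indB  : Fin k → Bool
    singB : Fin k → Bool
    subB  : Fin k → Fin k → Bool
open BMatrix public

cmp1 : ℕ → Cmp
cmp1 zero          = lt
cmp1 (suc zero)    = eq
cmp1 (suc (suc _)) = gt

registry : ∀ {k n} → IndepStr n → Vec (Subset n) k → Registry k
registry M Ys = record
  { indR  = λ i → does (Indep? M (lookup Ys i))
  ; singR = λ i → cmp1 ∣ lookup Ys i ∣
  ; subR  = λ i j → does (lookup Ys i ⊆? lookup Ys j)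
  }

sumSing : Cmp → Cmp → Bool
sumSing lt eq = true
sumSing eq lt = true
sumSing _  _  = false

_⊞_ : ∀ {k} → Registry k → Registry k → BMatrix k
r ⊞ r' = record
  { indB  = λ i → indR r i ∧ indR r' i
  ; singB = λ i → sumSing (singR r i) (singR r' i)
  ; subB  = λ i j → subR r i j ∧ subR r' i j
  }

evalB : ∀ {k} → QF k → BMatrix k → Bool
evalB (sub i j) ω = subB ω i j
evalB (sing i)  ω = singB ω i
evalB (ind i)   ω = indB ω i
evalB (neg φ)   ω = Data.Bool.not (evalB φ ω)
evalB (and φ χ) ω = evalB φ ω ∧ evalB χ ω

-- depth-d trees; a depth-(d+1) tree is a nonempty finite set of depth-d
-- trees, represented by a nonempty list (only membership matters)
data Tree (k : ℕ) : ℕ → Set where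
  leaf : Registry k → Tree k 0
  node : ∀ {d} → List⁺ (Tree k d) → Tree k (suc d)

children : ∀ {k d} → Tree k (suc d) → List⁺ (Tree k d)
children (node ts) = ts

-- depth k - l, computed from a witness of l ≤ k
depthOf : ∀ {l k} → l ≤‴ k → ℕ
depthOf (≤‴-reflexive _) = zero
depthOf (≤‴-step g)      = suc (depthOf g)

toGap : ∀ {k l} → Prenex k l → l ≤‴ k
toGap (qf _)  = ≤‴-reflexive refl
toGap (ex ψ)  = ≤‴-step (toGap ψ)
toGap (all ψ) = ≤‴-step (toGap ψ)

allSubsets : (n : ℕ) → List⁺ (Subset n)
allSubsets zero    = [ [] ]
allSubsets (suc n) = map⁺ (true ∷_) (allSubsets n) ⁺++⁺ map⁺ (false ∷_) (allSubsets n)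

𝒯 : ∀ {k l n} → IndepStr n → (g : l ≤‴ k) → Vec (Subset n) l → Tree k (depthOf g)
𝒯 {n = n} M (≤‴-reflexive e) Ys = leaf (registry M (subst (Vec (Subset n)) e Ys))
𝒯 {n = n} M (≤‴-step g) Ys = node (map⁺ (λ Y → 𝒯 M g (Ys ∷ʳ Y)) (allSubsets n))

Compatible : ∀ {k l} (ψ : Prenex k l) → Tree k (depthOf (toGap ψ)) → Tree k (depthOf (toGap ψ)) → Set
Compatible (qf φ) (leaf r) (leaf r') = evalB φ (r ⊞ r') ≡ true
Compatible (ex ψ) t t' =
  Any (λ t₀ → Any (λ t₀' → Compatible ψ t₀ t₀') (toList (children t'))) (toList (children t))
Compatible (all ψ) t t' =
  All (λ t₀ → All (λ t₀' → Compatible ψ t₀ t₀') (toList (children t'))) (toList (children t))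

-- Every subset of E(M ⊕ M') is Y ∪ Y' with Y ⊆ E(M) and Y' ⊆ E(M'), and the atomic predicates
-- split along this decomposition: Y ∪ Y' ⊆ Z ∪ Z' iff Y ⊆ Z and Y' ⊆ Z', Y ∪ Y' is independent iff
-- both parts are, and Y ∪ Y' is a singleton iff one part is empty and the other a singleton. Hence
-- the quantifier-free matrix holds in the sum exactly when it evaluates to T on the sum of the two
-- registries, and by induction on the quantifier prefix each quantifier over subsets of E(M ⊕ M')
-- becomes a pair of quantifiers over subsets of E(M) and E(M'), i.e. over the children of the two
-- trees.
module Submission where

open import Defs
open import Data.Nat using (ℕ; _≤_; _≤‴_; ≤‴-step; zero; suc; _+_)
open import Data.Empty using (⊥-elim)
open import Data.Fin using (Fin)
open import Data.Fin.Subset using (Subset; ∣_∣; inside; outside)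
open import Data.Fin.Subset.Properties using (_⊆?_)
open import Data.Vec using (Vec; zipWith; _++_; []; _∷_; _∷ʳ_; lookup; splitAt; take; drop)
open import Data.Vec.Properties using (lookup-zipWith; take++drop≡id; ++-injectiveˡ; ++-injectiveʳ)
open import Data.Bool using (Bool; true; _∧_)
open import Data.Product using (∃; ∃₂; _,_)
import Data.Product.Function.Dependent.Propositional as Σ
open import Data.List using (List)
import Data.List as List
open import Data.List.NonEmpty using (toList)
open import Data.List.Membership.Propositional using (lose)
open import Data.List.Membership.Propositional.Properties using (∈-map⁺; ∈-++⁺ˡ; ∈-++⁺ʳ)
open import Data.List.Relation.Unary.Any using (Any; here; satisfied)
import Data.List.Relation.Unary.Any.Properties as Any
open import Data.List.Relation.Unary.All using (All)
import Data.List.Relation.Unary.All as All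
import Data.List.Relation.Unary.All.Properties as All
open import Data.List.Relation.Unary.Enumerates.Setoid using (IsEnumeration)
open import Function using (_∘_)
open import Function.Bundles using (_⇔_; mk⇔; module Equivalence)
import Function.Properties.Equivalence as ⇔
open import Function.Related.Propositional using (module EquationalReasoning)
open import Relation.Nullary using (Reflects; ofʸ; ofⁿ; proof; does)
open import Relation.Nullary.Reflects using (_×-reflects_; ¬-reflects)
open import Relation.Binary.PropositionalEquality using (_≡_; refl; sym; cong; subst; setoid)

Reflects⇒⇔≡true : ∀ {A : Set} {b : Bool} → Reflects A b → A ⇔ (b ≡ true)
Reflects⇒⇔≡true (ofʸ a)  = mk⇔ (λ _ → refl) (λ _ → a)
Reflects⇒⇔≡true (ofⁿ ¬a) = mk⇔ (⊥-elim ∘ ¬a) (λ ())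

take-++ : ∀ {A : Set} {n m} (xs : Vec A n) (ys : Vec A m) → take n (xs ++ ys) ≡ xs
take-++ {n = n} xs ys = ++-injectiveˡ (take n (xs ++ ys)) xs (take++drop≡id n (xs ++ ys))

drop-++ : ∀ {A : Set} {n m} (xs : Vec A n) (ys : Vec A m) → drop n (xs ++ ys) ≡ ys
drop-++ {n = n} xs ys = ++-injectiveʳ (take n (xs ++ ys)) xs (take++drop≡id n (xs ++ ys))

zipWith-∷ʳ : ∀ {A B C : Set} {l} (f : A → B → C) (xs : Vec A l) (ys : Vec B l) x y →
             zipWith f (xs ∷ʳ x) (ys ∷ʳ y) ≡ zipWith f xs ys ∷ʳ f x y
zipWith-∷ʳ f []       []       x y = refl
zipWith-∷ʳ f (a ∷ xs) (b ∷ ys) x y = cong (f a b ∷_) (zipWith-∷ʳ f xs ys x y)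

module _ {A : Set} {n m : ℕ} {P : Vec A (n + m) → Set} where

  ∃-++ : ∃ P ⇔ (∃₂ λ xs ys → P (xs ++ ys))
  ∃-++ = mk⇔ split λ (xs , ys , p) → xs ++ ys , p
    where
    split : ∃ P → ∃₂ λ xs ys → P (xs ++ ys)
    split (zs , p) with splitAt n zs
    ... | xs , ys , refl = xs , ys , p

  ∀-++ : (∀ zs → P zs) ⇔ (∀ xs ys → P (xs ++ ys))
  ∀-++ = mk⇔ (λ h xs ys → h (xs ++ ys)) unsplit
    where
    unsplit : (∀ xs ys → P (xs ++ ys)) → ∀ zs → P zs
    unsplit h zs with splitAt n zs
    ... | xs , ys , refl = h xs ys

∀-cong : ∀ {A : Set} {P Q : A → Set} → (∀ x → P x ⇔ Q x) → (∀ x → P x) ⇔ (∀ x → Q x)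
∀-cong P⇔Q = mk⇔ (λ h x → Equivalence.to (P⇔Q x) (h x)) (λ h x → Equivalence.from (P⇔Q x) (h x))

∣p++q∣≡∣p∣+∣q∣ : ∀ {n m} (p : Subset n) (q : Subset m) → ∣ p ++ q ∣ ≡ ∣ p ∣ + ∣ q ∣
∣p++q∣≡∣p∣+∣q∣ []            q = refl
∣p++q∣≡∣p∣+∣q∣ (outside ∷ p) q = ∣p++q∣≡∣p∣+∣q∣ p q
∣p++q∣≡∣p∣+∣q∣ (inside ∷ p)  q = cong suc (∣p++q∣≡∣p∣+∣q∣ p q)

does-⊆?-++ : ∀ {n m} (p q : Subset n) (p' q' : Subset m) →
             does ((p ++ p') ⊆? (q ++ q')) ≡ does (p ⊆? q) ∧ does (p' ⊆? q')
does-⊆?-++ []            []            p' q' = refl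
does-⊆?-++ (outside ∷ p) (_ ∷ q)       p' q' = does-⊆?-++ p q p' q'
does-⊆?-++ (inside ∷ p)  (outside ∷ q) p' q' = refl
does-⊆?-++ (inside ∷ p)  (inside ∷ q)  p' q' = does-⊆?-++ p q p' q'

sumSing-reflects : ∀ a b → Reflects (a + b ≡ 1) (sumSing (cmp1 a) (cmp1 b))
sumSing-reflects zero          zero          = ofⁿ λ ()
sumSing-reflects zero          (suc zero)    = ofʸ refl
sumSing-reflects zero          (suc (suc b)) = ofⁿ λ ()
sumSing-reflects (suc zero)    zero          = ofʸ refl
sumSing-reflects (suc zero)    (suc zero)    = ofⁿ λ ()
sumSing-reflects (suc zero)    (suc (suc b)) = ofⁿ λ ()
sumSing-reflects (suc (suc a)) zero          = ofⁿ λ ()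
sumSing-reflects (suc (suc a)) (suc zero)    = ofⁿ λ ()
sumSing-reflects (suc (suc a)) (suc (suc b)) = ofⁿ λ ()

module _ {n m : ℕ} (M : IndepStr n) (M' : IndepStr m) where

  Indep-⊕-reflects : (Y : Subset n) (Y' : Subset m) →
                     Reflects (Indep (M ⊕ M') (Y ++ Y')) (does (Indep? M Y) ∧ does (Indep? M' Y'))
  Indep-⊕-reflects Y Y' rewrite take-++ Y Y' | drop-++ Y Y' =
    proof (Indep? M Y) ×-reflects proof (Indep? M' Y')

  ⟦⟧-⊕-reflects : ∀ {k} (φ : QF k) (Ys : Vec (Subset n) k) (Ys' : Vec (Subset m) k) →
                  Reflects (⟦ φ ⟧ (M ⊕ M') (zipWith _++_ Ys Ys')) (evalB φ (registry M Ys ⊞ registry M' Ys'))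
  ⟦⟧-⊕-reflects (sub i j) Ys Ys'
    rewrite lookup-zipWith _++_ i Ys Ys' | lookup-zipWith _++_ j Ys Ys' =
    subst (Reflects _) (does-⊆?-++ (lookup Ys i) (lookup Ys j) (lookup Ys' i) (lookup Ys' j))
      (proof (_ ⊆? _))
  ⟦⟧-⊕-reflects (sing i) Ys Ys'
    rewrite lookup-zipWith _++_ i Ys Ys' | ∣p++q∣≡∣p∣+∣q∣ (lookup Ys i) (lookup Ys' i) =
    sumSing-reflects _ _
  ⟦⟧-⊕-reflects (ind i) Ys Ys' rewrite lookup-zipWith _++_ i Ys Ys' = Indep-⊕-reflects _ _
  ⟦⟧-⊕-reflects (neg φ)   Ys Ys' = ¬-reflects (⟦⟧-⊕-reflects φ Ys Ys')
  ⟦⟧-⊕-reflects (and φ χ) Ys Ys' = ⟦⟧-⊕-reflects φ Ys Ys' ×-reflects ⟦⟧-⊕-reflects χ Ys Ys'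

module _ {A B : Set} {xs : List A} (enum : IsEnumeration (setoid A) xs) (f : A → B) {P : B → Set} where

  Any-map-enumeration : Any P (List.map f xs) ⇔ ∃ (P ∘ f)
  Any-map-enumeration = mk⇔ (satisfied ∘ Any.map⁻) λ (x , p) → Any.map⁺ (lose (enum x) p)

  All-map-enumeration : All P (List.map f xs) ⇔ (∀ x → P (f x))
  All-map-enumeration =
    mk⇔ (λ ps x → All.lookup (All.map⁻ ps) (enum x)) λ h → All.map⁺ (All.tabulate λ {x} _ → h x)

allSubsets-isEnumeration : ∀ n → IsEnumeration (setoid (Subset n)) (toList (allSubsets n))
allSubsets-isEnumeration zero    []            = here refl
allSubsets-isEnumeration (suc n) (inside ∷ Y)  =
  ∈-++⁺ˡ (∈-map⁺ (inside ∷_) (allSubsets-isEnumeration n Y))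
allSubsets-isEnumeration (suc n) (outside ∷ Y) =
  ∈-++⁺ʳ (List.map (inside ∷_) (toList (allSubsets n))) (∈-map⁺ (outside ∷_) (allSubsets-isEnumeration n Y))

module _ {k l n : ℕ} (M : IndepStr n) (g : suc l ≤‴ k) (Ys : Vec (Subset n) l) {P : Tree k (depthOf g) → Set} where

  Any-children-𝒯 : Any P (toList (children (𝒯 M (≤‴-step g) Ys))) ⇔ ∃ λ Y → P (𝒯 M g (Ys ∷ʳ Y))
  Any-children-𝒯 = Any-map-enumeration (allSubsets-isEnumeration n) _

  All-children-𝒯 : All P (toList (children (𝒯 M (≤‴-step g) Ys))) ⇔ (∀ Y → P (𝒯 M g (Ys ∷ʳ Y)))
  All-children-𝒯 = All-map-enumeration (allSubsets-isEnumeration n) _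

module _ {n m : ℕ} (M : IndepStr n) (M' : IndepStr m) where

  Sat-⊕⇔Compatible : ∀ {k l} (ψ : Prenex k l) (Ys : Vec (Subset n) l) (Ys' : Vec (Subset m) l) →
    Sat (M ⊕ M') (zipWith _++_ Ys Ys') ψ ⇔ Compatible ψ (𝒯 M (toGap ψ) Ys) (𝒯 M' (toGap ψ) Ys')

  Sat-⊕-∷ʳ⇔Compatible : ∀ {k l} (ψ : Prenex k (suc l)) (Ys : Vec (Subset n) l) (Ys' : Vec (Subset m) l) Y Y' →
    Sat (M ⊕ M') (zipWith _++_ Ys Ys' ∷ʳ (Y ++ Y')) ψ ⇔
    Compatible ψ (𝒯 M (toGap ψ) (Ys ∷ʳ Y)) (𝒯 M' (toGap ψ) (Ys' ∷ʳ Y'))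
  Sat-⊕-∷ʳ⇔Compatible ψ Ys Ys' Y Y' rewrite sym (zipWith-∷ʳ _++_ Ys Ys' Y Y') =
    Sat-⊕⇔Compatible ψ (Ys ∷ʳ Y) (Ys' ∷ʳ Y')

  Sat-⊕⇔Compatible (qf φ)  Ys Ys' = Reflects⇒⇔≡true (⟦⟧-⊕-reflects M M' φ Ys Ys')
  Sat-⊕⇔Compatible (ex ψ)  Ys Ys' = begin
    (∃ λ Z → Sat (M ⊕ M') (zipWith _++_ Ys Ys' ∷ʳ Z) ψ)
      ∼⟨ ∃-++ ⟩
    (∃₂ λ Y Y' → Sat (M ⊕ M') (zipWith _++_ Ys Ys' ∷ʳ (Y ++ Y')) ψ)
      ∼⟨ Σ.congˡ (Σ.congˡ (Sat-⊕-∷ʳ⇔Compatible ψ Ys Ys' _ _)) ⟩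
    (∃₂ λ Y Y' → Compatible ψ (𝒯 M (toGap ψ) (Ys ∷ʳ Y)) (𝒯 M' (toGap ψ) (Ys' ∷ʳ Y')))
      ∼⟨ Σ.congˡ (⇔.sym (Any-children-𝒯 M' (toGap ψ) Ys')) ⟩
    (∃ λ Y → Any (Compatible ψ (𝒯 M (toGap ψ) (Ys ∷ʳ Y))) (toList (children (𝒯 M' (toGap (ex ψ)) Ys'))))
      ∼⟨ ⇔.sym (Any-children-𝒯 M (toGap ψ) Ys) ⟩
    Compatible (ex ψ) (𝒯 M (toGap (ex ψ)) Ys) (𝒯 M' (toGap (ex ψ)) Ys') ∎
    where open EquationalReasoning
  Sat-⊕⇔Compatible (all ψ) Ys Ys' = begin
    (∀ Z → Sat (M ⊕ M') (zipWith _++_ Ys Ys' ∷ʳ Z) ψ)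
      ∼⟨ ∀-++ ⟩
    (∀ Y Y' → Sat (M ⊕ M') (zipWith _++_ Ys Ys' ∷ʳ (Y ++ Y')) ψ)
      ∼⟨ ∀-cong (λ Y → ∀-cong (Sat-⊕-∷ʳ⇔Compatible ψ Ys Ys' Y)) ⟩
    (∀ Y Y' → Compatible ψ (𝒯 M (toGap ψ) (Ys ∷ʳ Y)) (𝒯 M' (toGap ψ) (Ys' ∷ʳ Y')))
      ∼⟨ ∀-cong (λ Y → ⇔.sym (All-children-𝒯 M' (toGap ψ) Ys')) ⟩
    (∀ Y → All (Compatible ψ (𝒯 M (toGap ψ) (Ys ∷ʳ Y))) (toList (children (𝒯 M' (toGap (all ψ)) Ys'))))
      ∼⟨ ⇔.sym (All-children-𝒯 M (toGap ψ) Ys) ⟩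
    Compatible (all ψ) (𝒯 M (toGap (all ψ)) Ys) (𝒯 M' (toGap (all ψ)) Ys') ∎
    where open EquationalReasoning

proposition3p1 : (k : ℕ) → 1 ≤ k → {l : ℕ} (ψ : Prenex k l) →
    ((i : Fin k) → Occurs i (matrix ψ)) →
    {n m : ℕ} (M : IndepStr n) (M' : IndepStr m) → IsMatroid M → IsMatroid M' →
    (Ys : Vec (Subset n) l) (Ys' : Vec (Subset m) l) →
    Sat (M ⊕ M') (zipWith _++_ Ys Ys') ψ ⇔ Compatible ψ (𝒯 M (toGap ψ) Ys) (𝒯 M' (toGap ψ) Ys')
proposition3p1 k _ ψ _ M M' _ _ = Sat-⊕⇔Compatible M M' ψ
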